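{- Let $N\in\mathbb{N}$, let $y=(y_1,y_2,\dots)$ be variables, and let $A=\big(e_{i-j}(y_{(i)})\big)_{0\le i,j\le N-1}$ and $B=\big(h_{i-j}((-y)_{(j+1)})\big)_{0\le i,j\le N-1}$. Then $A$ and $B$ are inverse matrices.
   Context: For $p\ge0$, $y_{(p)}$ denotes the variables $y_1,\dots,y_p$ and $(-y)_{(p)}$ denotes $-y_1,\dots,-y_p$. The elementary and complete symmetric polynomials are defined by $\prod_{i=1}^p(1+y_it)=\sum_{r\ge0}e_r(y_{(p)})t^r$ and $\prod_{i=1}^p(1-y_it)^{ -1}=\sum_{r\ge0}h_r(y_{(p)})t^r$ (so $e_0=h_0=1$, $e_r(y_{(p)})=0$ for $r>p$, and for $p=0$ the empty product is $1$); for $r<0$, $e_r=h_r=0$. -}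

module Defs where

open import Level using (Level)
open import Algebra.Bundles using (CommutativeRing)
open import Data.Nat using (ℕ; zero; suc; _∸_)
open import Data.Integer using (ℤ; +_; -[1+_]; _⊖_)
open import Data.Fin using (Fin; toℕ; _≟_)
open import Relation.Nullary using (yes; no)

-- Symmetric polynomials evaluated in an arbitrary commutative ring R
-- at a sequence of values ys : ℕ → Carrier, where the variable y_i is ys i
-- for i ≥ 1 (ys 0 is unused).
module Sym {c ℓ : Level} (R : CommutativeRing c ℓ) where
  open CommutativeRing R hiding (_-_)

  sumUpTo : ℕ → (ℕ → Carrier) → Carrier
  sumUpTo zero    f = 0#
  sumUpTo (suc n) f = sumUpTo n f + f n

  sumFin : (n : ℕ) → (Fin n → Carrier) → Carrier
  sumFin zero    f = 0#
  sumFin (suc n) f = f Fin.zero + sumFin n (λ i → f (Fin.suc i))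

  pow : Carrier → ℕ → Carrier
  pow a zero    = 1#
  pow a (suc k) = a * pow a k

  -- formal power series in t, as coefficient sequences
  Ser : Set c
  Ser = ℕ → Carrier

  oneS : Ser
  oneS zero    = 1#
  oneS (suc _) = 0#

  conv : Ser → Ser → Ser
  conv f g n = sumUpTo (suc n) (λ k → f k * g (n ∸ k))

  prodS : (ℕ → Ser) → ℕ → Ser
  prodS F zero    = oneS
  prodS F (suc p) = conv (prodS F p) (F (suc p))

  linS : Carrier → Ser
  linS a zero          = 1#
  linS a (suc zero)    = a
  linS a (suc (suc _)) = 0#

  -- (1 - a t)^{-1} = Σ_k a^k t^k
  geomS : Carrier → Ser
  geomS a k = pow a k

  e : ℕ → (ℕ → Carrier) → ℕ → Carrier
  e r ys p = prodS (λ i → linS (ys i)) p r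

  h : ℕ → (ℕ → Carrier) → ℕ → Carrier
  h r ys p = prodS (λ i → geomS (ys i)) p r

  eℤ : ℤ → (ℕ → Carrier) → ℕ → Carrier
  eℤ (+ r)    ys p = e r ys p
  eℤ -[1+ _ ] ys p = 0#

  hℤ : ℤ → (ℕ → Carrier) → ℕ → Carrier
  hℤ (+ r)    ys p = h r ys p
  hℤ -[1+ _ ] ys p = 0#

  Mat : ℕ → Set c
  Mat N = Fin N → Fin N → Carrier

  _⊗_ : {N : ℕ} → Mat N → Mat N → Mat N
  _⊗_ {N} X Y i j = sumFin N (λ k → X i k * Y k j)

  I : (N : ℕ) → Mat N
  I N i j with i ≟ j
  ... | yes _ = 1#
  ... | no  _ = 0#

  A : (ℕ → Carrier) → (N : ℕ) → Mat N
  A ys N i j = eℤ (toℕ i ⊖ toℕ j) ys (toℕ i)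

  B : (ℕ → Carrier) → (N : ℕ) → Mat N
  B ys N i j = hℤ (toℕ i ⊖ toℕ j) (λ k → - ys k) (suc (toℕ j))

-- Both matrices are "Pascal arrays": lower unitriangular arrays f whose rows
-- obey a recurrence  f(i+1,k) = f(i,k-1) + w(i,k) f(i,k).  For A the weight
-- is y_{i+1} (it depends on the row), for B it is -y_{k+1} (it depends on the
-- column).  The recurrences are the coefficientwise forms of the series
-- identities  E_{p+1} = (1 + y_{p+1} t) E_p  and  (1 - x_{p+1} t) H_{p+1} = H_p.
--
-- The core is the purely combinatorial statement: if a is a Pascal array with
-- row weight α i and b one with column weight -α j, then ab = ba = 1.  It is
-- proved by induction on the row index, peeling one step of each recurrence
-- off the row–column sums; all cross terms cancel because the weights are
-- opposite.

module Submission where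

open import Defs
open import Level using (Level)
open import Algebra.Bundles using (CommutativeRing)
open import Data.Nat using (ℕ)
open import Data.Fin using (Fin)
open import Data.Product using (_×_)

open import Data.Nat using (zero; suc; _∸_; _≤_; _<_; s≤s)
import Data.Nat.Properties as NP
open import Data.Integer using (ℤ; +_; -[1+_]; _⊖_)
open import Data.Integer.Properties using ([1+m]⊖[1+n]≡m⊖n)
open import Data.Fin as F using (toℕ)
open import Data.Fin.Properties using (toℕ-injective; toℕ<n)
open import Data.Product using (_,_)
open import Data.Empty using (⊥-elim)
open import Relation.Nullary using (yes; no; ¬_)
open import Relation.Binary.PropositionalEquality as P using (_≡_)

module InverseMatrices {c ℓ : Level} (R : CommutativeRing c ℓ) where
  open CommutativeRing R hiding (_-_; zero)
  open Sym R
  open import Relation.Binary.Reasoning.Setoid setoid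

  ≡⇒≈ : ∀ {u v} → u ≡ v → u ≈ v
  ≡⇒≈ P.refl = refl

  *-swapˡ : ∀ u v w → u * (v * w) ≈ v * (u * w)
  *-swapˡ u v w = begin
    u * (v * w) ≈⟨ *-assoc u v w ⟨
    (u * v) * w ≈⟨ *-cong (*-comm u v) refl ⟩
    (v * u) * w ≈⟨ *-assoc v u w ⟩
    v * (u * w) ∎

  +-swapˡ : ∀ u v w → u + (v + w) ≈ v + (u + w)
  +-swapˡ u v w = begin
    u + (v + w) ≈⟨ +-assoc u v w ⟨
    (u + v) + w ≈⟨ +-cong (+-comm u v) refl ⟩
    (v + u) + w ≈⟨ +-assoc v u w ⟩
    v + (u + w) ∎

  +-*-zeroʳ : ∀ u v → u + v * 0# ≈ u
  +-*-zeroʳ u v = trans (+-cong refl (zeroʳ v)) (+-identityʳ u)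

  sum-cong : ∀ n {f g : ℕ → Carrier} → (∀ k → f k ≈ g k) → sumUpTo n f ≈ sumUpTo n g
  sum-cong zero    f≈g = refl
  sum-cong (suc n) f≈g = +-cong (sum-cong n f≈g) (f≈g n)

  sum-cong-< : ∀ n {f g : ℕ → Carrier} → (∀ k → k < n → f k ≈ g k) → sumUpTo n f ≈ sumUpTo n g
  sum-cong-< zero    f≈g = refl
  sum-cong-< (suc n) f≈g =
    +-cong (sum-cong-< n (λ k k<n → f≈g k (NP.m<n⇒m<1+n k<n))) (f≈g n NP.≤-refl)

  sum-zero : ∀ n {f : ℕ → Carrier} → (∀ k → f k ≈ 0#) → sumUpTo n f ≈ 0#
  sum-zero zero    f≈0 = refl
  sum-zero (suc n) f≈0 = trans (+-cong (sum-zero n f≈0) (f≈0 n)) (+-identityˡ 0#)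

  sum-+ : ∀ n (f g : ℕ → Carrier) → sumUpTo n (λ k → f k + g k) ≈ sumUpTo n f + sumUpTo n g
  sum-+ zero    f g = sym (+-identityˡ 0#)
  sum-+ (suc n) f g = begin
    sumUpTo n (λ k → f k + g k) + (f n + g n) ≈⟨ +-cong (sum-+ n f g) refl ⟩
    (sumUpTo n f + sumUpTo n g) + (f n + g n) ≈⟨ +-assoc _ _ _ ⟩
    sumUpTo n f + (sumUpTo n g + (f n + g n)) ≈⟨ +-cong refl (+-swapˡ _ _ _) ⟩
    sumUpTo n f + (f n + (sumUpTo n g + g n)) ≈⟨ +-assoc _ _ _ ⟨
    (sumUpTo n f + f n) + (sumUpTo n g + g n) ∎

  sum-* : ∀ n s (f : ℕ → Carrier) → sumUpTo n (λ k → s * f k) ≈ s * sumUpTo n f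
  sum-* zero    s f = sym (zeroʳ s)
  sum-* (suc n) s f = trans (+-cong (sum-* n s f) refl) (sym (distribˡ s _ _))

  sum-first : ∀ n (f : ℕ → Carrier) → sumUpTo (suc n) f ≈ f 0 + sumUpTo n (λ k → f (suc k))
  sum-first zero    f = +-comm 0# (f 0)
  sum-first (suc n) f = trans (+-cong (sum-first n f) refl) (+-assoc _ _ _)

  sumFin-toℕ : ∀ n {F : Fin n → Carrier} {f : ℕ → Carrier} →
               (∀ k → F k ≈ f (toℕ k)) → sumFin n F ≈ sumUpTo n f
  sumFin-toℕ zero    F≈f = refl
  sumFin-toℕ (suc n) {f = f} F≈f = begin
    _ + sumFin n _                    ≈⟨ +-cong (F≈f F.zero) (sumFin-toℕ n (λ k → F≈f (F.suc k))) ⟩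
    f 0 + sumUpTo n (λ k → f (suc k)) ≈⟨ sum-first n f ⟨
    sumUpTo (suc n) f                 ∎

  -- Multiplication by t: shifts all coefficients up by one degree.
  shiftS : Ser → Ser
  shiftS f zero    = 0#
  shiftS f (suc r) = f r

  shiftS-cong : ∀ {f g : Ser} → (∀ r → f r ≈ g r) → ∀ r → shiftS f r ≈ shiftS g r
  shiftS-cong f≈g zero    = refl
  shiftS-cong f≈g (suc r) = f≈g r

  conv-congʳ : ∀ f {g g′ : Ser} → (∀ r → g r ≈ g′ r) → ∀ n → conv f g n ≈ conv f g′ n
  conv-congʳ f g≈g′ n = sum-cong (suc n) (λ k → *-cong refl (g≈g′ (n ∸ k)))

  conv-linearʳ : ∀ f g h s n →
                 conv f (λ r → g r + s * h r) n ≈ conv f g n + s * conv f h n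
  conv-linearʳ f g h s n = begin
    sumUpTo (suc n) (λ k → f k * (g (n ∸ k) + s * h (n ∸ k)))
      ≈⟨ sum-cong (suc n) (λ k → trans (distribˡ _ _ _) (+-cong refl (*-swapˡ _ _ _))) ⟩
    sumUpTo (suc n) (λ k → f k * g (n ∸ k) + s * (f k * h (n ∸ k)))
      ≈⟨ sum-+ (suc n) _ _ ⟩
    conv f g n + sumUpTo (suc n) (λ k → s * (f k * h (n ∸ k)))
      ≈⟨ +-cong refl (sum-* (suc n) s _) ⟩
    conv f g n + s * conv f h n ∎

  conv-oneʳ : ∀ f n → conv f oneS n ≈ f n
  conv-oneʳ f n = begin
    sumUpTo n (λ k → f k * oneS (n ∸ k)) + f n * oneS (n ∸ n)
      ≈⟨ +-cong (trans (sum-cong-< n (λ k k<n → trans (*-cong refl (≡⇒≈ (oneS-above k<n))) (zeroʳ _)))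
                       (sum-zero n (λ _ → refl)))
                (*-cong refl (≡⇒≈ (P.cong oneS (NP.n∸n≡0 n)))) ⟩
    0# + f n * 1# ≈⟨ trans (+-identityˡ _) (*-identityʳ _) ⟩
    f n ∎
    where
    oneS-above : ∀ {k m} → k < m → oneS (m ∸ k) ≡ 0#
    oneS-above {zero}  {suc m} _         = P.refl
    oneS-above {suc k} {suc m} (s≤s k<m) = oneS-above k<m

  conv-shiftʳ : ∀ f g n → conv f (shiftS g) n ≈ shiftS (conv f g) n
  conv-shiftʳ f g zero    = +-*-zeroʳ 0# (f 0)
  conv-shiftʳ f g (suc n) = begin
    sumUpTo (suc n) (λ k → f k * shiftS g (suc n ∸ k)) + f (suc n) * shiftS g (n ∸ n)
      ≈⟨ +-cong (sum-cong-< (suc n) (λ k k<sn → *-cong refl (≡⇒≈ (shiftS-∸ (NP.≤-pred k<sn)))))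
                (*-cong refl (≡⇒≈ (P.cong (shiftS g) (NP.n∸n≡0 n)))) ⟩
    conv f g n + f (suc n) * 0# ≈⟨ +-*-zeroʳ _ _ ⟩
    conv f g n ∎
    where
    shiftS-∸ : ∀ {k} → k ≤ n → shiftS g (suc n ∸ k) ≡ g (n ∸ k)
    shiftS-∸ k≤n = P.cong (shiftS g) (NP.+-∸-assoc 1 k≤n)

  linS-decomp : ∀ s r → linS s r ≈ oneS r + s * shiftS oneS r
  linS-decomp s zero          = sym (+-*-zeroʳ 1# s)
  linS-decomp s (suc zero)    = sym (trans (+-identityˡ _) (*-identityʳ s))
  linS-decomp s (suc (suc r)) = sym (+-*-zeroʳ 0# s)

  geomS-decomp : ∀ s r → geomS s r ≈ oneS r + s * shiftS (geomS s) r
  geomS-decomp s zero    = sym (+-*-zeroʳ 1# s)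
  geomS-decomp s (suc r) = sym (+-identityˡ _)

  conv-linS : ∀ f s r → conv f (linS s) r ≈ f r + s * shiftS f r
  conv-linS f s r = begin
    conv f (linS s) r
      ≈⟨ conv-congʳ f (linS-decomp s) r ⟩
    conv f (λ r → oneS r + s * shiftS oneS r) r
      ≈⟨ conv-linearʳ f oneS (shiftS oneS) s r ⟩
    conv f oneS r + s * conv f (shiftS oneS) r
      ≈⟨ +-cong (conv-oneʳ f r) (*-cong refl (conv-shiftʳ f oneS r)) ⟩
    f r + s * shiftS (conv f oneS) r
      ≈⟨ +-cong refl (*-cong refl (shiftS-cong (conv-oneʳ f) r)) ⟩
    f r + s * shiftS f r ∎

  conv-geomS : ∀ f s r → conv f (geomS s) r ≈ f r + s * shiftS (conv f (geomS s)) r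
  conv-geomS f s r = begin
    conv f (geomS s) r
      ≈⟨ conv-congʳ f (geomS-decomp s) r ⟩
    conv f (λ r → oneS r + s * shiftS (geomS s) r) r
      ≈⟨ conv-linearʳ f oneS (shiftS (geomS s)) s r ⟩
    conv f oneS r + s * conv f (shiftS (geomS s)) r
      ≈⟨ +-cong (conv-oneʳ f r) (*-cong refl (conv-shiftʳ f (geomS s) r)) ⟩
    f r + s * shiftS (conv f (geomS s)) r ∎

  e-step : ∀ ys p r → e r ys (suc p) ≈ e r ys p + ys (suc p) * shiftS (λ r → e r ys p) r
  e-step ys p = conv-linS (λ r → e r ys p) (ys (suc p))

  h-step : ∀ xs p r → h r xs (suc p) ≈ h r xs p + xs (suc p) * shiftS (λ r → h r xs (suc p)) r
  h-step xs p = conv-geomS (λ r → h r xs p) (xs (suc p))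

  e-vanish : ∀ ys {p r} → p < r → e r ys p ≈ 0#
  e-vanish ys {zero}  {suc r} _         = refl
  e-vanish ys {suc p} {suc r} (s≤s p<r) = begin
    e (suc r) ys (suc p)                 ≈⟨ e-step ys p (suc r) ⟩
    e (suc r) ys p + ys (suc p) * e r ys p
      ≈⟨ +-cong (e-vanish ys (NP.m<n⇒m<1+n p<r)) (*-cong refl (e-vanish ys p<r)) ⟩
    0# + ys (suc p) * 0#                 ≈⟨ +-*-zeroʳ 0# _ ⟩
    0#                                   ∎

  ext : Ser → ℤ → Carrier
  ext f (+ r)    = f r
  ext f -[1+ _ ] = 0#

  eℤ≡ext : ∀ z ys p → eℤ z ys p ≡ ext (λ r → e r ys p) z
  eℤ≡ext (+ r)    ys p = P.refl
  eℤ≡ext -[1+ _ ] ys p = P.refl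

  hℤ≡ext : ∀ z xs p → hℤ z xs p ≡ ext (λ r → h r xs p) z
  hℤ≡ext (+ r)    xs p = P.refl
  hℤ≡ext -[1+ _ ] xs p = P.refl

  ext-step : ∀ {u v w : Ser} {s} → (∀ r → u r ≈ v r + s * shiftS w r) →
             ∀ m n → ext u (m ⊖ n) ≈ ext v (m ⊖ n) + s * ext w (m ⊖ suc n)
  ext-step rec zero    zero    = rec zero
  ext-step rec (suc m) zero    = rec (suc m)
  ext-step rec zero    (suc n) = sym (+-*-zeroʳ 0# _)
  ext-step rec (suc m) (suc n)
    rewrite [1+m]⊖[1+n]≡m⊖n m n | [1+m]⊖[1+n]≡m⊖n m (suc n) = ext-step rec m n

  δ : ℕ → ℕ → Carrier
  δ zero    zero    = 1#
  δ zero    (suc _) = 0#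
  δ (suc _) zero    = 0#
  δ (suc i) (suc j) = δ i j

  shiftS-δ : ∀ i j → shiftS (δ i) j ≡ δ (suc i) j
  shiftS-δ i zero    = P.refl
  shiftS-δ i (suc j) = P.refl

  δ-diag : ∀ i → δ i i ≈ 1#
  δ-diag zero    = refl
  δ-diag (suc i) = δ-diag i

  δ-off : ∀ i j → ¬ i ≡ j → δ i j ≈ 0#
  δ-off zero    zero    i≢j = ⊥-elim (i≢j P.refl)
  δ-off zero    (suc j) i≢j = refl
  δ-off (suc i) zero    i≢j = refl
  δ-off (suc i) (suc j) i≢j = δ-off i j (λ i≡j → i≢j (P.cong suc i≡j))

  δ-annihilate : ∀ s i j → (i ≡ j → s ≈ 0#) → s * δ i j ≈ 0#
  δ-annihilate s i j s≈0 with i NP.≟ j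
  ... | yes i≡j = trans (*-cong (s≈0 i≡j) refl) (zeroˡ _)
  ... | no  i≢j = trans (*-cong refl (δ-off i j i≢j)) (zeroʳ s)

  Arr : Set c
  Arr = ℕ → ℕ → Carrier

  mul : ℕ → Arr → Arr → Arr
  mul n f g i j = sumUpTo n (λ k → f i k * g k j)

  record Pascal (w f : Arr) : Set (c Level.⊔ ℓ) where
    field
      first-row : ∀ k → f 0 k ≈ δ 0 k
      next-row  : ∀ i k → f (suc i) k ≈ shiftS (f i) k + w i k * f i k

  module _ {w f : Arr} (pf : Pascal w f) where
    open Pascal pf

    triangular : ∀ {i k} → i < k → f i k ≈ 0#
    triangular {zero}  {suc k} _         = first-row (suc k)
    triangular {suc i} {suc k} (s≤s i<k) = begin
      f (suc i) (suc k)                ≈⟨ next-row i (suc k) ⟩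
      f i k + w i (suc k) * f i (suc k)
        ≈⟨ +-cong (triangular i<k) (*-cong refl (triangular (NP.m<n⇒m<1+n i<k))) ⟩
      0# + w i (suc k) * 0#            ≈⟨ +-*-zeroʳ 0# _ ⟩
      0#                               ∎

    mul-first-row : ∀ n g j → mul (suc n) f g 0 j ≈ g 0 j
    mul-first-row n g j = begin
      mul (suc n) f g 0 j ≈⟨ sum-first n _ ⟩
      f 0 0 * g 0 j + sumUpTo n (λ k → f 0 (suc k) * g (suc k) j)
        ≈⟨ +-cong (*-cong (first-row 0) refl)
                  (sum-zero n (λ k → trans (*-cong (first-row (suc k)) refl) (zeroˡ _))) ⟩
      1# * g 0 j + 0#     ≈⟨ trans (+-identityʳ _) (*-identityˡ _) ⟩
      g 0 j               ∎

    mul-next-row : ∀ n g i j →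
      mul (suc n) f g (suc i) j
        ≈ mul n f (λ k → g (suc k)) i j + sumUpTo (suc n) (λ k → (w i k * f i k) * g k j)
    mul-next-row n g i j = begin
      sumUpTo (suc n) (λ k → f (suc i) k * g k j)
        ≈⟨ sum-cong (suc n) (λ k → trans (*-cong (next-row i k) refl) (distribʳ _ _ _)) ⟩
      sumUpTo (suc n) (λ k → shiftS (f i) k * g k j + (w i k * f i k) * g k j)
        ≈⟨ sum-+ (suc n) _ _ ⟩
      sumUpTo (suc n) (λ k → shiftS (f i) k * g k j) + _
        ≈⟨ +-cong (sum-first n _) refl ⟩
      (0# * g 0 j + mul n f (λ k → g (suc k)) i j) + _
        ≈⟨ +-cong (trans (+-cong (zeroˡ _) refl) (+-identityˡ _)) refl ⟩
      mul n f (λ k → g (suc k)) i j + _ ∎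

    mul-next-col : ∀ n g i j →
      mul n g (λ k → f (suc k)) i j
        ≈ shiftS (mul n g f i) j + sumUpTo n (λ k → g i k * (w k j * f k j))
    mul-next-col n g i j = begin
      sumUpTo n (λ k → g i k * f (suc k) j)
        ≈⟨ sum-cong n (λ k → trans (*-cong refl (next-row k j)) (distribˡ _ _ _)) ⟩
      sumUpTo n (λ k → g i k * shiftS (f k) j + g i k * (w k j * f k j))
        ≈⟨ sum-+ n _ _ ⟩
      sumUpTo n (λ k → g i k * shiftS (f k) j) + _
        ≈⟨ +-cong (sum-shiftS j) refl ⟩
      shiftS (mul n g f i) j + _ ∎
      where
      sum-shiftS : ∀ j → sumUpTo n (λ k → g i k * shiftS (f k) j) ≈ shiftS (mul n g f i) j
      sum-shiftS zero    = sum-zero n (λ k → zeroʳ _)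
      sum-shiftS (suc j) = refl

  sum-pullˡ : ∀ n s (f g : ℕ → Carrier) →
              sumUpTo n (λ k → (s * f k) * g k) ≈ s * sumUpTo n (λ k → f k * g k)
  sum-pullˡ n s f g = trans (sum-cong n (λ k → *-assoc s (f k) (g k))) (sum-* n s _)

  sum-pullʳ : ∀ n s (f g : ℕ → Carrier) →
              sumUpTo n (λ k → f k * (s * g k)) ≈ s * sumUpTo n (λ k → f k * g k)
  sum-pullʳ n s f g = trans (sum-cong n (λ k → *-swapˡ (f k) s (g k))) (sum-* n s _)

  -- The core: a Pascal array with row weights α and one with column weights
  -- -α are mutually inverse (every truncation past the row index is exact).
  module _ (α : ℕ → Carrier) {a b : Arr}
           (pa : Pascal (λ i _ → α i) a) (pb : Pascal (λ _ j → - α j) b) where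

    inverseʳ : ∀ i {n} → i < n → ∀ j → mul n a b i j ≈ δ i j
    inverseʳ zero    {suc n} _ j = trans (mul-first-row pa n b j) (Pascal.first-row pb j)
    inverseʳ (suc i) {suc n} (s≤s i<n) j = begin
      mul (suc n) a b (suc i) j
        ≈⟨ mul-next-row pa n b i j ⟩
      mul n a (λ k → b (suc k)) i j + sumUpTo (suc n) (λ k → (α i * a i k) * b k j)
        ≈⟨ +-cong (mul-next-col pb n a i j) (sum-pullˡ (suc n) (α i) _ _) ⟩
      (shiftS (mul n a b i) j + sumUpTo n (λ k → a i k * (- α j * b k j)))
        + α i * mul (suc n) a b i j
        ≈⟨ +-cong (+-cong refl (sum-pullʳ n (- α j) _ _)) refl ⟩
      (shiftS (mul n a b i) j + - α j * mul n a b i j) + α i * mul (suc n) a b i j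
        ≈⟨ +-cong (+-cong (shiftS-cong (inverseʳ i i<n) j) (*-cong refl (inverseʳ i i<n j)))
                  (*-cong refl (inverseʳ i (NP.m<n⇒m<1+n i<n) j)) ⟩
      (shiftS (δ i) j + - α j * δ i j) + α i * δ i j
        ≈⟨ trans (+-assoc _ _ _) (+-cong (≡⇒≈ (shiftS-δ i j)) (sym (distribʳ _ _ _))) ⟩
      δ (suc i) j + (- α j + α i) * δ i j
        ≈⟨ +-cong refl (δ-annihilate _ i j diagonal) ⟩
      δ (suc i) j + 0#
        ≈⟨ +-identityʳ _ ⟩
      δ (suc i) j ∎
      where
      diagonal : i ≡ j → - α j + α i ≈ 0#
      diagonal P.refl = -‿inverseˡ (α i)

    inverseˡ : ∀ i {n} → i < n → ∀ j → mul n b a i j ≈ δ i j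
    inverseˡ zero    {suc n} _ j = trans (mul-first-row pb n a j) (Pascal.first-row pa j)
    inverseˡ (suc i) {suc n} (s≤s i<n) j = begin
      mul (suc n) b a (suc i) j
        ≈⟨ mul-next-row pb n a i j ⟩
      mul n b (λ k → a (suc k)) i j + sumUpTo (suc n) (λ k → (- α k * b i k) * a k j)
        ≈⟨ +-cong (mul-next-col pa n b i j) drop-last ⟩
      (shiftS (mul n b a i) j + sumUpTo n (λ k → b i k * (α k * a k j)))
        + sumUpTo n (λ k → (- α k * b i k) * a k j)
        ≈⟨ +-assoc _ _ _ ⟩
      shiftS (mul n b a i) j
        + (sumUpTo n (λ k → b i k * (α k * a k j)) + sumUpTo n (λ k → (- α k * b i k) * a k j))
        ≈⟨ +-cong (shiftS-cong (inverseˡ i i<n) j) (trans (sym (sum-+ n _ _)) (sum-zero n cancel)) ⟩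
      shiftS (δ i) j + 0#
        ≈⟨ trans (+-identityʳ _) (≡⇒≈ (shiftS-δ i j)) ⟩
      δ (suc i) j ∎
      where
      -- The last term involves b(i,n) with i < n, which is zero.
      drop-last : sumUpTo (suc n) (λ k → (- α k * b i k) * a k j)
                ≈ sumUpTo n (λ k → (- α k * b i k) * a k j)
      drop-last = trans (+-cong refl last≈0) (+-identityʳ _)
        where
        last≈0 : (- α n * b i n) * a n j ≈ 0#
        last≈0 = trans (*-cong (trans (*-cong refl (triangular pb i<n)) (zeroʳ _)) refl) (zeroˡ _)

      -- The weights α k and -α k of the two recurrences cancel termwise.
      cancel : ∀ k → b i k * (α k * a k j) + (- α k * b i k) * a k j ≈ 0#
      cancel k = begin
        b i k * (α k * a k j) + (- α k * b i k) * a k j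
          ≈⟨ +-cong (trans (*-swapˡ _ _ _) (sym (*-assoc _ _ _))) refl ⟩
        (α k * b i k) * a k j + (- α k * b i k) * a k j
          ≈⟨ trans (sym (distribʳ _ _ _)) (*-cong (sym (distribʳ _ _ _)) refl) ⟩
        ((α k + - α k) * b i k) * a k j
          ≈⟨ *-cong (*-cong (-‿inverseʳ (α k)) refl) refl ⟩
        (0# * b i k) * a k j
          ≈⟨ trans (*-cong (zeroˡ _) refl) (zeroˡ _) ⟩
        0# ∎

  I≈δ : ∀ N (i j : Fin N) → I N i j ≈ δ (toℕ i) (toℕ j)
  I≈δ N i j with i F.≟ j
  ... | yes P.refl = sym (δ-diag (toℕ i))
  ... | no  i≢j    = sym (δ-off (toℕ i) (toℕ j) (λ eq → i≢j (toℕ-injective eq)))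

  module Entries (ys : ℕ → Carrier) where

    a : Arr
    a i k = ext (λ r → e r ys i) (i ⊖ k)

    xs : ℕ → Carrier
    xs k = - ys k

    b : Arr
    b k j = ext (λ r → h r xs (suc j)) (k ⊖ j)

    a-Pascal : Pascal (λ i _ → ys (suc i)) a
    a-Pascal = record { first-row = first-row ; next-row = next-row }
      where
      first-row : ∀ k → a 0 k ≈ δ 0 k
      first-row zero    = refl
      first-row (suc k) = refl

      next-row : ∀ i k → a (suc i) k ≈ shiftS (a i) k + ys (suc i) * a i k
      next-row i zero    = trans (e-step ys i (suc i)) (+-cong (e-vanish ys {i} NP.≤-refl) refl)
      next-row i (suc k) rewrite [1+m]⊖[1+n]≡m⊖n i k = ext-step (e-step ys i) i k

    b-Pascal : Pascal (λ _ j → - ys (suc j)) b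
    b-Pascal = record { first-row = first-row ; next-row = next-row }
      where
      first-row : ∀ j → b 0 j ≈ δ 0 j
      first-row zero    = trans (h-step xs 0 0) (+-*-zeroʳ 1# _)
      first-row (suc j) = refl

      next-row : ∀ k j → b (suc k) j ≈ shiftS (b k) j + - ys (suc j) * b k j
      next-row k zero    = h-step xs 0 (suc k)
      next-row k (suc j) rewrite [1+m]⊖[1+n]≡m⊖n k j = ext-step (h-step xs (suc j)) k j

    A≈a : ∀ N (i k : Fin N) → A ys N i k ≈ a (toℕ i) (toℕ k)
    A≈a N i k = ≡⇒≈ (eℤ≡ext (toℕ i ⊖ toℕ k) ys (toℕ i))

    B≈b : ∀ N (k j : Fin N) → B ys N k j ≈ b (toℕ k) (toℕ j)
    B≈b N k j = ≡⇒≈ (hℤ≡ext (toℕ k ⊖ toℕ j) xs (suc (toℕ j)))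

    A⊗B≈I : ∀ N (i j : Fin N) → (A ys N ⊗ B ys N) i j ≈ I N i j
    A⊗B≈I N i j = begin
      (A ys N ⊗ B ys N) i j
        ≈⟨ sumFin-toℕ N (λ k → *-cong (A≈a N i k) (B≈b N k j)) ⟩
      mul N a b (toℕ i) (toℕ j)
        ≈⟨ inverseʳ (λ i → ys (suc i)) a-Pascal b-Pascal (toℕ i) (toℕ<n i) (toℕ j) ⟩
      δ (toℕ i) (toℕ j)
        ≈⟨ I≈δ N i j ⟨
      I N i j ∎

    B⊗A≈I : ∀ N (i j : Fin N) → (B ys N ⊗ A ys N) i j ≈ I N i j
    B⊗A≈I N i j = begin
      (B ys N ⊗ A ys N) i j
        ≈⟨ sumFin-toℕ N (λ k → *-cong (B≈b N i k) (A≈a N k j)) ⟩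
      mul N b a (toℕ i) (toℕ j)
        ≈⟨ inverseˡ (λ i → ys (suc i)) a-Pascal b-Pascal (toℕ i) (toℕ<n i) (toℕ j) ⟩
      δ (toℕ i) (toℕ j)
        ≈⟨ I≈δ N i j ⟨
      I N i j ∎

lemma4p2 : {c ℓ : Level} (R : CommutativeRing c ℓ) →
    (ys : ℕ → CommutativeRing.Carrier R) (N : ℕ) →
    ((i j : Fin N) → CommutativeRing._≈_ R (Sym._⊗_ R (Sym.A R ys N) (Sym.B R ys N) i j) (Sym.I R N i j))
    × ((i j : Fin N) → CommutativeRing._≈_ R (Sym._⊗_ R (Sym.B R ys N) (Sym.A R ys N) i j) (Sym.I R N i j))
lemma4p2 R ys N = A⊗B≈I N , B⊗A≈I N
  where open InverseMatrices.Entries R ys
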